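{- Let $3 \leq r < m$ and $d \geq 2$ be integers, and let $T$ be a bi-regular Moore tree with parameters $r, m, d$ and root $\mathsf{w}$. For $j \geq 0$ let $L_j$ be the set of vertices of $T$ at distance $j$ from $\mathsf{w}$, and let $L_{j,m}$ be the set of vertices in $L_j$ of degree $m$ (in $T$). Then \[ |V(T)| = |L_0| + |L_1| \sum_{i=0}^{d-1} (r-1)^i + (m-r) \sum_{j=1}^{d-1} |L_{j,m}| \sum_{i=0}^{d-1-j} (r-1)^i . \]
   Context: All graphs are finite, simple and undirected. The distance between a vertex $u$ and an edge $\{v,w\}$ is $\min(\mathrm{dist}(u,v),\mathrm{dist}(u,w))$. A bi-regular Moore tree with parameters $r,m,d$ and root $\mathsf{w}$ is a tree $T$ together with a root $\mathsf{w}$ which is either a vertex $v_{\mathsf{w}}$ or an edge $\{u_{\mathsf{w}}, v_{\mathsf{w}}\}$ of $T$, such that: $r < m$; the vertex $v_{\mathsf{w}}$ has degree $m$; every internal (non-leaf) vertex of $T$ has degree $r$ or $m$; and the distance between $\mathsf{w}$ and every leaf of $T$ equals $d$. Vertices at distance $j$ from $\mathsf{w}$ (vertex-to-vertex or vertex-to-edge distance, according to the type of root) are said to be at level $j$. -}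

module Defs where

open import Data.Nat using (ℕ; zero; suc; _+_; _*_; _∸_; _^_; _≤_; _<_; _⊓_; _≡ᵇ_)
open import Data.Bool using (Bool; true; false; if_then_else_; _∧_)
open import Data.Fin using (Fin)
open import Data.List using (List; []; _∷_; _++_; [_]; map; allFin)
open import Data.Nat.ListAction using (sum)
open import Data.Sum using (_⊎_)
open import Data.List.Relation.Unary.Unique.Propositional using (Unique)
open import Data.Product using (Σ; ∃; ∃-syntax; _×_)
open import Data.Unit using (⊤)
open import Relation.Nullary using (¬_)
open import Relation.Binary.PropositionalEquality using (_≡_)

record Graph : Set where
  field
    n      : ℕ
    adj    : Fin n → Fin n → Bool
    sym    : ∀ u v → adj u v ≡ adj v u
    irrefl : ∀ v → adj v v ≡ false
open Graph public

count : {n : ℕ} → (Fin n → Bool) → ℕ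
count {n} P = sum (map (λ i → if P i then 1 else 0) (allFin n))

∑ : ℕ → (ℕ → ℕ) → ℕ
∑ zero    f = 0
∑ (suc k) f = ∑ k f + f k

module _ (G : Graph) where

  deg : Fin (n G) → ℕ
  deg v = count (adj G v)

  data Walk : Fin (n G) → Fin (n G) → ℕ → Set where
    nil  : ∀ x → Walk x x 0
    cons : ∀ {x y z k} → adj G x y ≡ true → Walk y z k → Walk x z (suc k)

  Dist : Fin (n G) → Fin (n G) → ℕ → Set
  Dist u v k = Walk u v k × (∀ j → Walk u v j → k ≤ j)

  Connected : Set
  Connected = ∀ u v → ∃[ k ] Walk u v k

  Chain : List (Fin (n G)) → Set
  Chain []           = ⊤
  Chain (x ∷ [])     = ⊤
  Chain (x ∷ y ∷ xs) = (adj G x y ≡ true) × Chain (y ∷ xs)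

  HasCycle : Set
  HasCycle = ∃[ x ] ∃[ y ] ∃[ z ] ∃[ rest ]
    (Unique (x ∷ y ∷ z ∷ rest) × Chain ((x ∷ y ∷ z ∷ rest) ++ [ x ]))

  IsTree : Set
  IsTree = Connected × ¬ HasCycle

  IsLeaf : Fin (n G) → Set
  IsLeaf v = deg v ≡ 1

  -- root: a vertex v_w, or an edge {u_w, v_w}
  data Root : Set where
    vroot : (v : Fin (n G)) → Root
    eroot : (u v : Fin (n G)) → adj G u v ≡ true → Root

  rootV : Root → Fin (n G)
  rootV (vroot v)     = v
  rootV (eroot u v _) = v

  RDist : Root → Fin (n G) → ℕ → Set
  RDist (vroot v)     x j = Dist v x j
  RDist (eroot u v _) x j = ∃[ a ] ∃[ b ] (Dist u x a × Dist v x b × j ≡ a ⊓ b)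

  IsBiregularMooreTree : ℕ → ℕ → ℕ → Root → Set
  IsBiregularMooreTree r m d w =
    IsTree × r < m × deg (rootV w) ≡ m
    × (∀ v → ¬ IsLeaf v → (deg v ≡ r ⊎ deg v ≡ m))
    × (∀ v → IsLeaf v → RDist w v d)

  -- |L_j| and |L_{j,m}| given the level function lev (lev x = distance from the root)
  levelSize : (Fin (n G) → ℕ) → ℕ → ℕ
  levelSize lev j = count (λ x → lev x ≡ᵇ j)

  levelSizeDeg : (Fin (n G) → ℕ) → ℕ → ℕ → ℕ
  levelSizeDeg lev j m = count (λ x → (lev x ≡ᵇ j) ∧ (deg x ≡ᵇ m))

-- Because the tree has no cycle, a vertex at level j ≥ 1 has exactly one neighbour at level j - 1 and
-- all its other neighbours at level j + 1: a second parent, or an edge inside a level, would close a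
-- cycle through common ancestors. Counting the edges between levels j and j + 1 from both sides gives
-- |L_{j+1}| = (r - 1)|L_j| + (m - r)|L_{j,m}| for 1 ≤ j < d, where no vertex is a leaf. Leaves lie at
-- level d, so no vertex lies deeper, and summing the solved recurrence over the levels 0, …, d counts
-- every vertex exactly once.
module Submission where

open import Defs renaming (sym to adj-comm)
open import Data.Nat using (ℕ; zero; suc; _+_; _*_; _∸_; _^_; _≤_; _<_; _≡ᵇ_; z≤n; s≤s; s≤s⁻¹)
open import Data.Nat.Properties
-- ∑[ i < n ] _ does not record n, so these lemmas often need their size argument explicitly.
open import Algebra.Properties.Semiring.Sum +-*-semiring
  using (sum-syntax; sum-cong-≗; sum-replicate-zero; sum-init-last; sum-remove; ∑-comm; ∑-distrib-+; *-distribˡ-sum)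
open import Data.Nat.Tactic.RingSolver using (solve-∀)
open import Data.Bool using (Bool; true; false; if_then_else_; _∧_)
open import Data.Bool.Properties using (T-≡; ∧-zeroʳ)
open import Data.Empty using (⊥)
open import Data.Fin using (Fin; zero; suc; toℕ; fromℕ<; punchIn)
open import Data.Fin.Properties using (toℕ-inject₁; toℕ-fromℕ; toℕ-fromℕ<; toℕ-injective; punchInᵢ≢i) renaming (_≟_ to _≟ᶠ_)
open import Data.List using (List; _∷_; _++_; [_]; map; tabulate; allFin)
open import Data.List.Extrema.Nat using (argmax; f[xs]≤f[argmax])
open import Data.List.Membership.Propositional using (_∈_)
open import Data.List.Membership.Propositional.Properties using (∈-allFin)
open import Data.List.Relation.Unary.All as All using (All; []; _∷_)
open import Data.List.Relation.Unary.All.Properties as All using ()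
open import Data.List.Relation.Unary.Any using (here)
open import Data.List.Relation.Unary.AllPairs using ([]; _∷_)
open import Data.List.Relation.Unary.Unique.Propositional using (Unique)
open import Data.List.Relation.Unary.Unique.Propositional.Properties as Unique using ()
open import Data.Nat.ListAction using (sum)
open import Data.Product using (∃-syntax; _×_; _,_)
open import Data.Sum using (_⊎_; inj₁; inj₂)
open import Data.Unit using (tt)
open import Function using (_∘_; Equivalence)
open import Relation.Nullary using (¬_; yes; no)
open import Relation.Nullary.Decidable using (dec-true; dec-false)
open import Relation.Nullary.Negation using (contradiction)
open import Relation.Binary using (tri<; tri≈; tri>)
open import Relation.Binary.PropositionalEquality hiding ([_])

-- does (m ≟ n) computes to m ≡ᵇ n.
≡ᵇ-true : ∀ {m n} → m ≡ n → (m ≡ᵇ n) ≡ true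
≡ᵇ-true {m} {n} = dec-true (m ≟ n)

≡ᵇ-false : ∀ {m n} → m ≢ n → (m ≡ᵇ n) ≡ false
≡ᵇ-false {m} {n} = dec-false (m ≟ n)

≡ᵇ-true⁻¹ : ∀ {m n} → (m ≡ᵇ n) ≡ true → m ≡ n
≡ᵇ-true⁻¹ {m} {n} e = ≡ᵇ⇒≡ m n (Equivalence.from T-≡ e)

𝟙 : Bool → ℕ
𝟙 b = if b then 1 else 0

𝟙-∧ : ∀ a b → 𝟙 (a ∧ b) ≡ 𝟙 a * 𝟙 b
𝟙-∧ true  b = sym (+-identityʳ (𝟙 b))
𝟙-∧ false b = refl

sum-map-tabulate : ∀ {A : Set} n (g : Fin n → A) (f : A → ℕ) →
                   sum (map f (tabulate g)) ≡ ∑[ i < n ] f (g i)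
sum-map-tabulate zero    g f = refl
sum-map-tabulate (suc n) g f = cong (f (g zero) +_) (sum-map-tabulate n (g ∘ suc) f)

count≡∑ : ∀ {n} (P : Fin n → Bool) → count P ≡ ∑[ i < n ] 𝟙 (P i)
count≡∑ {n} P = sum-map-tabulate n (λ i → i) (𝟙 ∘ P)

∑-𝟙-unique : ∀ {n} (P : Fin n → Bool) {x₀} → P x₀ ≡ true → (∀ x → P x ≡ true → x ≡ x₀) →
             ∑[ x < n ] 𝟙 (P x) ≡ 1
∑-𝟙-unique {suc n} P {x₀} Px₀ unique = begin
  ∑[ x < suc n ] 𝟙 (P x)                       ≡⟨ sum-remove {i = x₀} (𝟙 ∘ P) ⟩
  𝟙 (P x₀) + ∑[ j < n ] 𝟙 (P (punchIn x₀ j))  ≡⟨ cong₂ _+_ (cong 𝟙 Px₀) (sum-cong-≗ P≢) ⟩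
  1 + ∑[ j < n ] 0                             ≡⟨ cong suc (sum-replicate-zero n) ⟩
  1                                            ∎
  where
  open ≡-Reasoning
  P≢ : ∀ j → 𝟙 (P (punchIn x₀ j)) ≡ 0
  P≢ j with P (punchIn x₀ j) in e
  ... | true  = contradiction (unique _ e) (punchInᵢ≢i x₀ j)
  ... | false = refl

∑-𝟙-none : ∀ {n} (P : Fin n → Bool) → (∀ x → P x ≡ false) → ∑[ x < n ] 𝟙 (P x) ≡ 0
∑-𝟙-none {n} P none = trans (sum-cong-≗ {n} (cong 𝟙 ∘ none)) (sum-replicate-zero n)

∑≡∑[<] : ∀ k (f : ℕ → ℕ) → ∑ k f ≡ ∑[ i < k ] f (toℕ i)
∑≡∑[<] zero    f = refl
∑≡∑[<] (suc k) f = trans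
  (cong₂ _+_ (trans (∑≡∑[<] k f) (sum-cong-≗ {k} (cong f ∘ sym ∘ toℕ-inject₁)))
             (cong f (sym (toℕ-fromℕ k))))
  (sym (sum-init-last {k} (f ∘ toℕ)))

∑[<]-const-1 : ∀ n → ∑[ i < n ] 1 ≡ n
∑[<]-const-1 zero    = refl
∑[<]-const-1 (suc n) = cong suc (∑[<]-const-1 n)

size≡∑-fibre-counts : ∀ {n K} (f : Fin n → ℕ) → (∀ x → f x < K) →
                      n ≡ ∑ K (λ j → count (λ x → f x ≡ᵇ j))
size≡∑-fibre-counts {n} {K} f f<K = begin
  n                                      ≡⟨ sym (∑[<]-const-1 n) ⟩
  ∑[ x < n ] 1                           ≡⟨ sum-cong-≗ {n} (sym ∘ one-fibre) ⟩
  ∑[ x < n ] ∑[ j < K ] 𝟙 (f x ≡ᵇ toℕ j) ≡⟨ ∑-comm {n} {K} (λ x j → 𝟙 (f x ≡ᵇ toℕ j)) ⟩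
  ∑[ j < K ] ∑[ x < n ] 𝟙 (f x ≡ᵇ toℕ j) ≡⟨ sum-cong-≗ {K} (λ j → sym (count≡∑ (λ x → f x ≡ᵇ toℕ j))) ⟩
  ∑[ j < K ] count (λ x → f x ≡ᵇ toℕ j)  ≡⟨ sym (∑≡∑[<] K (λ j → count (λ x → f x ≡ᵇ j))) ⟩
  ∑ K (λ j → count (λ x → f x ≡ᵇ j))     ∎
  where
  open ≡-Reasoning
  one-fibre : ∀ x → ∑[ j < K ] 𝟙 (f x ≡ᵇ toℕ j) ≡ 1
  one-fibre x = ∑-𝟙-unique (λ j → f x ≡ᵇ toℕ j) (≡ᵇ-true (sym (toℕ-fromℕ< (f<K x)))) only
    where
    only : ∀ j → (f x ≡ᵇ toℕ j) ≡ true → j ≡ fromℕ< (f<K x)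
    only j e = toℕ-injective (trans (sym (≡ᵇ-true⁻¹ e)) (sym (toℕ-fromℕ< (f<K x))))

∑-shift : ∀ k (f : ℕ → ℕ) → ∑ (suc k) f ≡ f 0 + ∑ k (f ∘ suc)
∑-shift zero    f = +-comm 0 (f 0)
∑-shift (suc k) f = trans (cong (_+ f (suc k)) (∑-shift k f)) (+-assoc (f 0) _ _)

*-distribˡ-∑ : ∀ k c (f : ℕ → ℕ) → c * ∑ k f ≡ ∑ k (λ i → c * f i)
*-distribˡ-∑ zero    c f = *-zeroʳ c
*-distribˡ-∑ (suc k) c f = trans (*-distribˡ-+ c (∑ k f) (f k)) (cong (_+ c * f k) (*-distribˡ-∑ k c f))

geometric-suc : ∀ q k → ∑ (suc k) (q ^_) ≡ 1 + q * ∑ k (q ^_)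
geometric-suc q k = trans (∑-shift k (q ^_)) (cong (1 +_) (sym (*-distribˡ-∑ k q (q ^_))))

∑-recurrence : ∀ q R n (ℓ μ : ℕ → ℕ) → (∀ i → i < n → ℓ (suc i) ≡ q * ℓ i + R * μ i) →
               ∑ (suc n) ℓ ≡ ℓ 0 * ∑ (suc n) (q ^_) + R * ∑ n (λ t → μ t * ∑ (n ∸ t) (q ^_))
∑-recurrence q R zero    ℓ μ _   = base (ℓ 0) R
  where
  base : ∀ l R → 0 + l ≡ l * (0 + 1) + R * 0
  base = solve-∀
∑-recurrence q R (suc n) ℓ μ rec = begin
  ∑ (suc (suc n)) ℓ
    ≡⟨ ∑-shift (suc n) ℓ ⟩
  ℓ 0 + ∑ (suc n) (ℓ ∘ suc)
    ≡⟨ cong (ℓ 0 +_) (∑-recurrence q R n (ℓ ∘ suc) (μ ∘ suc) rec′) ⟩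
  ℓ 0 + (ℓ 1 * A + R * B)
    ≡⟨ cong (λ z → ℓ 0 + (z * A + R * B)) (rec 0 (s≤s z≤n)) ⟩
  ℓ 0 + ((q * ℓ 0 + R * μ 0) * A + R * B)
    ≡⟨ regroup (ℓ 0) q R (μ 0) A B ⟩
  ℓ 0 * (1 + q * A) + R * (μ 0 * A + B)
    ≡⟨ sym (cong₂ (λ a b → ℓ 0 * a + R * b) (geometric-suc q (suc n)) (∑-shift n _)) ⟩
  ℓ 0 * ∑ (suc (suc n)) (q ^_) + R * ∑ (suc n) (λ t → μ t * ∑ (suc n ∸ t) (q ^_)) ∎
  where
  open ≡-Reasoning
  A B : ℕ
  A = ∑ (suc n) (q ^_)
  B = ∑ n (λ t → μ (suc t) * ∑ (n ∸ t) (q ^_))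
  rec′ : ∀ i → i < n → ℓ (suc (suc i)) ≡ q * ℓ (suc i) + R * μ (suc i)
  rec′ i i<n = rec (suc i) (s≤s i<n)
  regroup : ∀ l q R u A B → l + ((q * l + R * u) * A + R * B) ≡ l * (1 + q * A) + R * (u * A + B)
  regroup = solve-∀

pred-split : ∀ {r m} → 1 ≤ r → r ≤ m → m ∸ 1 ≡ (r ∸ 1) + (m ∸ r)
pred-split {suc r} {suc m} _ r≤m = sym (m+[n∸m]≡n (s≤s⁻¹ r≤m))

module _ (G : Graph) where

  adj-sym : ∀ {x y} → adj G x y ≡ true → adj G y x ≡ true
  adj-sym {x} {y} x~y = trans (adj-comm G y x) x~y

  adj-irrefl : ∀ {x y} → adj G x y ≡ true → x ≢ y
  adj-irrefl {x} x~x refl with () ← trans (sym x~x) (irrefl G x)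

  data Path : Fin (n G) → List (Fin (n G)) → Fin (n G) → Set where
    single : ∀ a → Path a [ a ] a
    step   : ∀ {a b c xs} → adj G a b ≡ true → Path b xs c → Path a (a ∷ xs) c

  neighbourCount : (Fin (n G) → Bool) → Fin (n G) → ℕ
  neighbourCount P x = ∑[ y < n G ] 𝟙 (adj G x y ∧ P y)

  neighbourCount-double : ∀ (P Q : Fin (n G) → Bool) →
    ∑[ x < n G ] (𝟙 (P x) * neighbourCount Q x) ≡ ∑[ y < n G ] (𝟙 (Q y) * neighbourCount P y)
  neighbourCount-double P Q = begin
    ∑[ x < n G ] (𝟙 (P x) * neighbourCount Q x)
      ≡⟨ sum-cong-≗ {n G} (λ x → *-distribˡ-sum {n G} (𝟙 (P x)) _) ⟩
    ∑[ x < n G ] ∑[ y < n G ] (𝟙 (P x) * 𝟙 (adj G x y ∧ Q y))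
      ≡⟨ sum-cong-≗ {n G} (λ x → sum-cong-≗ {n G} (edge-term x)) ⟩
    ∑[ x < n G ] ∑[ y < n G ] (𝟙 (Q y) * 𝟙 (adj G y x ∧ P x))
      ≡⟨ ∑-comm {n G} {n G} _ ⟩
    ∑[ y < n G ] ∑[ x < n G ] (𝟙 (Q y) * 𝟙 (adj G y x ∧ P x))
      ≡⟨ sum-cong-≗ {n G} (λ y → sym (*-distribˡ-sum {n G} (𝟙 (Q y)) _)) ⟩
    ∑[ y < n G ] (𝟙 (Q y) * neighbourCount P y) ∎
    where
    open ≡-Reasoning
    swap : ∀ a b c → a * (b * c) ≡ c * (b * a)
    swap = solve-∀
    edge-term : ∀ x y → 𝟙 (P x) * 𝟙 (adj G x y ∧ Q y) ≡ 𝟙 (Q y) * 𝟙 (adj G y x ∧ P x)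
    edge-term x y rewrite 𝟙-∧ (adj G x y) (Q y) | 𝟙-∧ (adj G y x) (P x) | adj-comm G x y =
      swap (𝟙 (P x)) (𝟙 (adj G y x)) (𝟙 (Q y))

module _ {G : Graph} where

  Walk-snoc : ∀ {a b c k} → Walk G a b k → adj G b c ≡ true → Walk G a c (suc k)
  Walk-snoc (nil _)    b~c = cons b~c (nil _)
  Walk-snoc (cons e p) b~c = cons e (Walk-snoc p b~c)

  Walk-unsnoc : ∀ {a c k} → Walk G a c (suc k) → ∃[ b ] (Walk G a b k × adj G b c ≡ true)
  Walk-unsnoc (cons e (nil _))      = _ , nil _ , e
  Walk-unsnoc (cons e p@(cons _ _)) with Walk-unsnoc p
  ... | b , q , b~c = b , cons e q , b~c

  Walk-zero : ∀ {a b} → Walk G a b 0 → a ≡ b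
  Walk-zero (nil _) = refl

  Path-snoc : ∀ {a b c xs} → Path G a xs b → adj G b c ≡ true → Path G a (xs ++ [ c ]) c
  Path-snoc (single _) b~c = step b~c (single _)
  Path-snoc (step e p) b~c = step e (Path-snoc p b~c)

  Path-closed-chain : ∀ {a b c xs} → Path G a xs b → adj G b c ≡ true → Chain G (xs ++ [ c ])
  Path-closed-chain (single _)            b~c = b~c , tt
  Path-closed-chain (step e p@(single _)) b~c = e , Path-closed-chain p b~c
  Path-closed-chain (step e p@(step _ _)) b~c = e , Path-closed-chain p b~c

  Path-cycle : ∀ {a b c xs} → Path G a xs b → a ≢ b → Unique xs → All (c ≢_) xs →
               adj G c a ≡ true → adj G b c ≡ true → HasCycle G
  Path-cycle (single _)            a≢a _ _  _   _   = contradiction refl a≢a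
  Path-cycle p@(step _ (single _)) _   u c∉ c~a b~c = _ , _ , _ , _ , c∉ ∷ u , c~a , Path-closed-chain p b~c
  Path-cycle p@(step _ (step _ _)) _   u c∉ c~a b~c = _ , _ , _ , _ , c∉ ∷ u , c~a , Path-closed-chain p b~c

IsRootVertex : (G : Graph) → Root G → Fin (n G) → Set
IsRootVertex G (vroot v)     x = x ≡ v
IsRootVertex G (eroot u v _) x = x ≡ u ⊎ x ≡ v

module _ {G : Graph} where

  rdist-walk : ∀ w {x j} → RDist G w x j → ∃[ ρ ] (IsRootVertex G w ρ × Walk G ρ x j)
  rdist-walk (vroot v)     (walk , _) = v , refl , walk
  rdist-walk (eroot u v _) (a , b , (walkᵤ , _) , (walkᵥ , _) , refl) with ≤-total a b
  ... | inj₁ a≤b = u , inj₁ refl , subst (Walk G u _) (sym (m≤n⇒m⊓n≡m a≤b)) walkᵤ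
  ... | inj₂ b≤a = v , inj₂ refl , subst (Walk G v _) (sym (m≥n⇒m⊓n≡n b≤a)) walkᵥ

  rdist-minimal : ∀ w {x ρ i j} → RDist G w x j → IsRootVertex G w ρ → Walk G ρ x i → j ≤ i
  rdist-minimal (vroot v) (_ , min) refl walk = min _ walk
  rdist-minimal (eroot u v _) (a , b , (_ , min) , _ , refl) (inj₁ refl) walk = ≤-trans (m⊓n≤m a b) (min _ walk)
  rdist-minimal (eroot u v _) (a , b , _ , (_ , min) , refl) (inj₂ refl) walk = ≤-trans (m⊓n≤n a b) (min _ walk)

  rdist-unique : ∀ w {x i j} → RDist G w x i → RDist G w x j → i ≡ j
  rdist-unique w dᵢ dⱼ with rdist-walk w dᵢ | rdist-walk w dⱼ
  ... | _ , ρ , walkᵢ | _ , σ , walkⱼ = ≤-antisym (rdist-minimal w dᵢ σ walkⱼ) (rdist-minimal w dⱼ ρ walkᵢ)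

  root-vertices-adjacent : ∀ w {a b} → IsRootVertex G w a → IsRootVertex G w b → a ≢ b → adj G a b ≡ true
  root-vertices-adjacent (vroot v)       refl        refl        a≢b = contradiction refl a≢b
  root-vertices-adjacent (eroot u v u~v) (inj₁ refl) (inj₁ refl) a≢b = contradiction refl a≢b
  root-vertices-adjacent (eroot u v u~v) (inj₁ refl) (inj₂ refl) _   = u~v
  root-vertices-adjacent (eroot u v u~v) (inj₂ refl) (inj₁ refl) _   = adj-sym G u~v
  root-vertices-adjacent (eroot u v u~v) (inj₂ refl) (inj₂ refl) a≢b = contradiction refl a≢b

module Levels {G : Graph} (w : Root G) (lev : Fin (n G) → ℕ) (lev-dist : ∀ x → RDist G w x (lev x)) where

  atLevel : ℕ → Fin (n G) → Bool
  atLevel j x = lev x ≡ᵇ j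

  neighboursAt : ℕ → Fin (n G) → ℕ
  neighboursAt j = neighbourCount G (atLevel j)

  lev-adj : ∀ {x y} → adj G x y ≡ true → lev y ≤ suc (lev x)
  lev-adj {x} x~y with rdist-walk w (lev-dist x)
  ... | _ , ρ , walk = rdist-minimal w (lev-dist _) ρ (Walk-snoc walk x~y)

  parent : ∀ {x k} → lev x ≡ suc k → ∃[ p ] (adj G x p ≡ true × lev p ≡ k)
  parent {x} {k} lx with rdist-walk w (lev-dist x)
  ... | _ , ρ , walk with Walk-unsnoc (subst (Walk G _ x) lx walk)
  ... | p , walkₚ , p~x = p , adj-sym G p~x , ≤-antisym below above
    where
    below : lev p ≤ k
    below = rdist-minimal w (lev-dist p) ρ walkₚ
    above : k ≤ lev p
    above = s≤s⁻¹ (subst (_≤ suc (lev p)) lx (lev-adj p~x))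

  level-zero-root : ∀ {x} → lev x ≡ 0 → IsRootVertex G w x
  level-zero-root {x} lx with rdist-walk w (lev-dist x)
  ... | _ , ρ , walk = subst (IsRootVertex G w) (Walk-zero (subst (Walk G _ x) lx walk)) ρ

  level-≢ : ∀ {a b k} → lev a ≡ suc k → lev b ≤ k → a ≢ b
  level-≢ la lb refl = 1+n≰n (subst (_≤ _) la lb)

  ancestor-path : ∀ k {a b} → lev a ≡ k → lev b ≡ k →
                  ∃[ xs ] (Path G a xs b × Unique xs × All (λ z → lev z ≤ k) xs)
  ancestor-path k {a} {b} la lb with a ≟ᶠ b
  ... | yes refl = [ a ] , single a , [] ∷ [] , ≤-reflexive la ∷ []
  ancestor-path zero    la lb | no a≢b =
    _ , step (root-vertices-adjacent w (level-zero-root la) (level-zero-root lb) a≢b) (single _) ,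
    (a≢b ∷ []) ∷ [] ∷ [] , ≤-reflexive la ∷ ≤-reflexive lb ∷ []
  ancestor-path (suc k) {a} {b} la lb | no a≢b with parent la | parent lb
  ... | _ , a~pa , lpa | _ , b~pb , lpb with ancestor-path k lpa lpb
  ... | xs , path , unique , low =
    _ , step a~pa (Path-snoc path (adj-sym G b~pb)) ,
    All.++⁺ (All.map (level-≢ la) low) (a≢b ∷ []) ∷ Unique.++⁺ unique ([] ∷ []) b∉xs ,
    ≤-reflexive la ∷ All.++⁺ (All.map m≤n⇒m≤1+n low) (≤-reflexive lb ∷ [])
    where
    b∉xs : ∀ {z} → ¬ (z ∈ xs × z ∈ [ b ])
    b∉xs (z∈xs , here refl) = level-≢ lb (All.lookup low z∈xs) refl

  module Acyclic (acyclic : ¬ HasCycle G) where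

    -- The cycle runs y, x, up from x's parent and down to y's parent, then back to y.
    no-edge-within-level : ∀ {x y k} → adj G x y ≡ true → lev x ≡ suc k → lev y ≡ suc k → ⊥
    no-edge-within-level x~y lx ly with parent lx | parent ly
    ... | _ , x~px , lpx | _ , y~py , lpy with ancestor-path _ lpx lpy
    ... | xs , path , unique , low =
      acyclic (Path-cycle (step x~px path) (level-≢ lx (≤-reflexive lpy)) (All.map (level-≢ lx) low ∷ unique)
                          (adj-irrefl G (adj-sym G x~y) ∷ All.map (level-≢ ly) low) (adj-sym G x~y) (adj-sym G y~py))

    unique-parent : ∀ {y p q k} → lev y ≡ suc k → adj G y p ≡ true → adj G y q ≡ true →
                    lev p ≡ k → lev q ≡ k → p ≡ q
    unique-parent {p = p} {q} ly y~p y~q lp lq with p ≟ᶠ q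
    ... | yes p≡q = p≡q
    ... | no p≢q with ancestor-path _ lp lq
    ... | xs , path , unique , low =
      contradiction (Path-cycle path p≢q unique (All.map (level-≢ ly) low) y~p (adj-sym G y~q)) acyclic

    neighbour-level : ∀ {x y k} → adj G x y ≡ true → lev x ≡ suc k → lev y ≡ k ⊎ lev y ≡ suc (suc k)
    neighbour-level {x} {y} {k} x~y lx with <-cmp (lev y) (suc k)
    ... | tri< y<x _ _ = inj₁ (≤-antisym (s≤s⁻¹ y<x) (s≤s⁻¹ (subst (_≤ suc (lev y)) lx (lev-adj (adj-sym G x~y)))))
    ... | tri≈ _ y≡x _ = contradiction y≡x (no-edge-within-level x~y lx)
    ... | tri> _ _ x<y = inj₂ (≤-antisym (subst (λ l → lev y ≤ suc l) lx (lev-adj x~y)) x<y)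

    parent-count : ∀ {x k} → lev x ≡ suc k → neighboursAt k x ≡ 1
    parent-count {x} {k} lx with parent lx
    ... | p , x~p , lp = ∑-𝟙-unique (λ y → adj G x y ∧ atLevel k y) (cong₂ _∧_ x~p (≡ᵇ-true lp)) only-p
      where
      only-p : ∀ y → (adj G x y ∧ atLevel k y) ≡ true → y ≡ p
      only-p y h with adj G x y in x~y
      ... | true = unique-parent lx x~y x~p (≡ᵇ-true⁻¹ h) lp

    deg-via-children : ∀ {x k} → lev x ≡ suc k → deg G x ≡ 1 + neighboursAt (suc (suc k)) x
    deg-via-children {x} {k} lx = begin
      deg G x
        ≡⟨ count≡∑ (adj G x) ⟩
      ∑[ y < n G ] 𝟙 (adj G x y)
        ≡⟨ sum-cong-≗ {n G} split ⟩
      ∑[ y < n G ] (𝟙 (adj G x y ∧ atLevel k y) + 𝟙 (adj G x y ∧ atLevel (suc (suc k)) y))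
        ≡⟨ ∑-distrib-+ {n G} _ _ ⟩
      neighboursAt k x + neighboursAt (suc (suc k)) x
        ≡⟨ cong (_+ neighboursAt (suc (suc k)) x) (parent-count lx) ⟩
      1 + neighboursAt (suc (suc k)) x ∎
      where
      open ≡-Reasoning
      split : ∀ y → 𝟙 (adj G x y) ≡ 𝟙 (adj G x y ∧ atLevel k y) + 𝟙 (adj G x y ∧ atLevel (suc (suc k)) y)
      split y with adj G x y in x~y
      ... | false = refl
      ... | true with neighbour-level x~y lx
      ... | inj₁ ly = sym (cong₂ (λ a b → 𝟙 a + 𝟙 b) (≡ᵇ-true ly) (≡ᵇ-false (m≢1+n+m k ∘ trans (sym ly))))
      ... | inj₂ ly = sym (cong₂ (λ a b → 𝟙 a + 𝟙 b) (≡ᵇ-false (λ e → m≢1+n+m k (trans (sym e) ly))) (≡ᵇ-true ly))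

    levelSize-suc : ∀ j → levelSize G lev (suc j) ≡ ∑[ p < n G ] (𝟙 (atLevel j p) * neighboursAt (suc j) p)
    levelSize-suc j = begin
      levelSize G lev (suc j)
        ≡⟨ count≡∑ (atLevel (suc j)) ⟩
      ∑[ y < n G ] 𝟙 (atLevel (suc j) y)
        ≡⟨ sum-cong-≗ {n G} weigh ⟩
      ∑[ y < n G ] (𝟙 (atLevel (suc j) y) * neighboursAt j y)
        ≡⟨ neighbourCount-double G (atLevel (suc j)) (atLevel j) ⟩
      ∑[ p < n G ] (𝟙 (atLevel j p) * neighboursAt (suc j) p) ∎
      where
      open ≡-Reasoning
      weigh : ∀ y → 𝟙 (atLevel (suc j) y) ≡ 𝟙 (atLevel (suc j) y) * neighboursAt j y
      weigh y with atLevel (suc j) y in e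
      ... | false = refl
      ... | true  = sym (trans (*-identityˡ _) (parent-count (≡ᵇ-true⁻¹ e)))

module BiregularMooreLevels {G : Graph} {w : Root G} {lev : Fin (n G) → ℕ}
  (lev-dist : ∀ x → RDist G w x (lev x)) (acyclic : ¬ HasCycle G) {r m d : ℕ} (1≤r : 1 ≤ r) (r<m : r < m)
  (internal-degree : ∀ v → ¬ IsLeaf G v → deg G v ≡ r ⊎ deg G v ≡ m)
  (leaf-depth : ∀ v → IsLeaf G v → RDist G w v d) where

  open Levels w lev lev-dist
  open Acyclic acyclic

  leaf-level : ∀ {x} → IsLeaf G x → lev x ≡ d
  leaf-level {x} leaf = rdist-unique w (lev-dist x) (leaf-depth x leaf)

  lev≤d : ∀ x → lev x ≤ d
  lev≤d x = ≤-trans (top-maximal x) (top≤d refl)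
    where
    top : Fin (n G)
    top = argmax lev (rootV G w) (allFin (n G))
    top-maximal : ∀ y → lev y ≤ lev top
    top-maximal y = All.lookup (f[xs]≤f[argmax] (rootV G w) (allFin (n G))) (∈-allFin y)
    top≤d : ∀ {l} → lev top ≡ l → l ≤ d
    top≤d {zero}  _  = z≤n
    top≤d {suc k} lt = ≤-reflexive (trans (sym lt) (leaf-level top-leaf))
      where
      childless : ∀ y → (adj G top y ∧ atLevel (suc (suc k)) y) ≡ false
      childless y = trans (cong (adj G top y ∧_) (≡ᵇ-false (λ ly → 1+n≰n (subst₂ _≤_ ly lt (top-maximal y)))))
                          (∧-zeroʳ _)
      top-leaf : deg G top ≡ 1
      top-leaf = trans (deg-via-children lt) (cong suc (∑-𝟙-none _ childless))

  degree-pred : ∀ {δ} → δ ≡ r ⊎ δ ≡ m → δ ∸ 1 ≡ (r ∸ 1) + (m ∸ r) * 𝟙 (δ ≡ᵇ m)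
  degree-pred (inj₁ refl) rewrite ≡ᵇ-false (<⇒≢ r<m) | *-zeroʳ (m ∸ r) = sym (+-identityʳ (r ∸ 1))
  degree-pred (inj₂ refl) rewrite ≡ᵇ-true (refl {x = m}) | *-identityʳ (m ∸ r) = pred-split 1≤r (<⇒≤ r<m)

  children-count : ∀ {p k} → lev p ≡ suc k → suc k < d →
                   neighboursAt (suc (suc k)) p ≡ (r ∸ 1) + (m ∸ r) * 𝟙 (deg G p ≡ᵇ m)
  children-count {p} lp k<d = trans (cong (_∸ 1) (sym (deg-via-children lp)))
    (degree-pred (internal-degree p (λ leaf → <⇒≢ k<d (trans (sym lp) (leaf-level leaf)))))

  levelSize-recurrence : ∀ {k} → suc k < d →
    levelSize G lev (suc (suc k)) ≡ (r ∸ 1) * levelSize G lev (suc k) + (m ∸ r) * levelSizeDeg G lev (suc k) m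
  levelSize-recurrence {k} k<d = begin
    levelSize G lev (suc (suc k))
      ≡⟨ levelSize-suc (suc k) ⟩
    ∑[ p < n G ] (𝟙 (L p) * neighboursAt (suc (suc k)) p)
      ≡⟨ sum-cong-≗ {n G} weigh ⟩
    ∑[ p < n G ] ((r ∸ 1) * 𝟙 (L p) + (m ∸ r) * 𝟙 (L p ∧ M p))
      ≡⟨ ∑-distrib-+ {n G} _ _ ⟩
    ∑[ p < n G ] ((r ∸ 1) * 𝟙 (L p)) + ∑[ p < n G ] ((m ∸ r) * 𝟙 (L p ∧ M p))
      ≡⟨ sym (cong₂ _+_ (*-distribˡ-sum {n G} (r ∸ 1) _) (*-distribˡ-sum {n G} (m ∸ r) _)) ⟩
    (r ∸ 1) * ∑[ p < n G ] 𝟙 (L p) + (m ∸ r) * ∑[ p < n G ] 𝟙 (L p ∧ M p)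
      ≡⟨ sym (cong₂ (λ a b → (r ∸ 1) * a + (m ∸ r) * b) (count≡∑ L) (count≡∑ (λ p → L p ∧ M p))) ⟩
    (r ∸ 1) * levelSize G lev (suc k) + (m ∸ r) * levelSizeDeg G lev (suc k) m ∎
    where
    open ≡-Reasoning
    L M : Fin (n G) → Bool
    L = atLevel (suc k)
    M p = deg G p ≡ᵇ m
    weigh : ∀ p → 𝟙 (L p) * neighboursAt (suc (suc k)) p ≡ (r ∸ 1) * 𝟙 (L p) + (m ∸ r) * 𝟙 (L p ∧ M p)
    weigh p with L p in e
    ... | false = sym (cong₂ _+_ (*-zeroʳ (r ∸ 1)) (*-zeroʳ (m ∸ r)))
    ... | true  = begin
      1 * neighboursAt (suc (suc k)) p ≡⟨ *-identityˡ _ ⟩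
      neighboursAt (suc (suc k)) p     ≡⟨ children-count (≡ᵇ-true⁻¹ e) k<d ⟩
      (r ∸ 1) + (m ∸ r) * 𝟙 (M p)      ≡⟨ cong (_+ (m ∸ r) * 𝟙 (M p)) (sym (*-identityʳ (r ∸ 1))) ⟩
      (r ∸ 1) * 1 + (m ∸ r) * 𝟙 (M p)  ∎

theorem2p1 : (r m d : ℕ) → 3 ≤ r → r < m → 2 ≤ d
    → (T : Graph) (w : Root T) → IsBiregularMooreTree T r m d w
    → (lev : Fin (n T) → ℕ) → (∀ x → RDist T w x (lev x))
    → n T ≡ levelSize T lev 0
          + levelSize T lev 1 * ∑ d (λ i → (r ∸ 1) ^ i)
          + (m ∸ r) * ∑ (d ∸ 1) (λ t → levelSizeDeg T lev (suc t) m
                                         * ∑ (d ∸ suc t) (λ i → (r ∸ 1) ^ i))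
theorem2p1 r m (suc d) 3≤r r<m _ T w ((_ , acyclic) , _ , _ , internal-degree , leaf-depth) lev lev-dist = begin
  n T                                                          ≡⟨ size≡∑-fibre-counts lev (s≤s ∘ lev≤d) ⟩
  ∑ (suc (suc d)) ℓ                                            ≡⟨ ∑-shift (suc d) ℓ ⟩
  ℓ 0 + ∑ (suc d) (ℓ ∘ suc)                                    ≡⟨ cong (ℓ 0 +_) (∑-recurrence q R d (ℓ ∘ suc) (μ ∘ suc) rec) ⟩
  ℓ 0 + (ℓ 1 * Q (suc d) + R * ∑ d (λ t → μ (suc t) * Q (d ∸ t))) ≡⟨ sym (+-assoc (ℓ 0) _ _) ⟩
  ℓ 0 + ℓ 1 * Q (suc d) + R * ∑ d (λ t → μ (suc t) * Q (d ∸ t))   ∎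
  where
  open BiregularMooreLevels lev-dist acyclic (≤-trans (s≤s z≤n) 3≤r) r<m internal-degree leaf-depth
  open ≡-Reasoning
  q R : ℕ
  q = r ∸ 1
  R = m ∸ r
  Q ℓ μ : ℕ → ℕ
  Q k = ∑ k (q ^_)
  ℓ = levelSize T lev
  μ j = levelSizeDeg T lev j m
  rec : ∀ i → i < d → ℓ (suc (suc i)) ≡ q * ℓ (suc i) + R * μ (suc i)
  rec _ i<d = levelSize-recurrence (s≤s i<d)
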